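{- For all real numbers $a, b$ and every integer $n \geq 1$, \[ c^V_{a,b}(n) = c^K_{a,b}(n). \]
   Context: Let $\mathcal{D}_n$ be the set of Dyck paths from $(0,0)$ to $(2n-2,0)$, i.e. lattice paths with steps $U=(1,1)$ and $D=(1,-1)$ never going below the $x$-axis (for $n=1$, only the empty path). For $P \in \mathcal{D}_n$: a valley is an occurrence of two consecutive steps $DU$ and a peak is an occurrence of two consecutive steps $UD$; $V(P)$ and $K(P)$ are the numbers of valleys and peaks of $P$; $U_V(P)$ is the number of up steps of $P$ not contained in a valley, and $U_K(P)$ is the number of up steps of $P$ not contained in a peak. Define $c^V_{a,b}(n) = \sum_{P \in \mathcal{D}_n} a^{U_V(P)} b^{V(P)}$ and $c^K_{a,b}(n) = \sum_{P \in \mathcal{D}_n} a^{K(P)} b^{U_K(P)}$ (convention $0^0=1$). -}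

module Defs where

open import Level using (Level)
open import Data.Nat using (ℕ; zero; suc) renaming (_*_ to _*ℕ_; _∸_ to _∸ℕ_)
open import Data.Bool using (Bool; true; false; if_then_else_)
open import Data.List using (List; []; _∷_; map; concatMap)
open import Algebra.Bundles using (CommutativeRing)

-- Steps of a lattice path: U = (1,1), D = (1,-1).
data Step : Set where
  U D : Step

words : ℕ → List (List Step)
words zero = [] ∷ []
words (suc k) = concatMap (λ w → (U ∷ w) ∷ (D ∷ w) ∷ []) (words k)

isDyckFrom : ℕ → List Step → Bool
isDyckFrom zero    []      = true
isDyckFrom (suc _) []      = false
isDyckFrom h       (U ∷ w) = isDyckFrom (suc h) w
isDyckFrom zero    (D ∷ w) = false
isDyckFrom (suc h) (D ∷ w) = isDyckFrom h w

isDyck : List Step → Bool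
isDyck = isDyckFrom zero

valleys : List Step → ℕ
valleys (D ∷ U ∷ w) = suc (valleys (U ∷ w))
valleys (_ ∷ w)     = valleys w
valleys []          = 0

peaks : List Step → ℕ
peaks (U ∷ D ∷ w) = suc (peaks (D ∷ w))
peaks (_ ∷ w)     = peaks w
peaks []          = 0

-- Up steps not contained in a valley: an up step lies in a valley iff it is
-- immediately preceded by a down step.  The Bool records whether the previous
-- step was D.
upsNotInValleyAux : Bool → List Step → ℕ
upsNotInValleyAux _     []      = 0
upsNotInValleyAux true  (U ∷ w) = upsNotInValleyAux false w
upsNotInValleyAux false (U ∷ w) = suc (upsNotInValleyAux false w)
upsNotInValleyAux _     (D ∷ w) = upsNotInValleyAux true w

upsNotInValley : List Step → ℕ
upsNotInValley = upsNotInValleyAux false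

-- Up steps not contained in a peak: an up step lies in a peak iff it is
-- immediately followed by a down step.
upsNotInPeak : List Step → ℕ
upsNotInPeak []          = 0
upsNotInPeak (U ∷ D ∷ w) = upsNotInPeak (D ∷ w)
upsNotInPeak (U ∷ w)     = suc (upsNotInPeak w)
upsNotInPeak (D ∷ w)     = upsNotInPeak w

module _ {c ℓ : Level} (R : CommutativeRing c ℓ) where
  open CommutativeRing R

  -- x ^ k with the convention x ^ 0 = 1 (so 0 ^ 0 = 1).
  pow : Carrier → ℕ → Carrier
  pow x zero    = 1#
  pow x (suc k) = x * pow x k

  sumDyck : (List Step → Carrier) → List (List Step) → Carrier
  sumDyck f []       = 0#
  sumDyck f (w ∷ ws) = (if isDyck w then f w else 0#) + sumDyck f ws

  -- D_n = Dyck paths from (0,0) to (2n-2,0).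
  cV : Carrier → Carrier → ℕ → Carrier
  cV a b n = sumDyck (λ P → pow a (upsNotInValley P) * pow b (valleys P))
                     (words (2 *ℕ (n ∸ℕ 1)))

  cK : Carrier → Carrier → ℕ → Carrier
  cK a b n = sumDyck (λ P → pow a (peaks P) * pow b (upsNotInPeak P))
                     (words (2 *ℕ (n ∸ℕ 1)))

-- Give every up step a factor.  For c^V it is b if the step follows a down
-- step (it lies in a valley) and a otherwise; for c^K it is a if the step is
-- followed by a down step (it lies in a peak) and b otherwise.  Both weights
-- factor along the first-return decomposition P = U u D v of a nonempty Dyck
-- path.  On the valley side the factor of U is a and the first up step of v
-- becomes a valley step, turning an a into b unless v is empty; on the peak
-- side v is unaffected and U is a peak step iff u is empty.  So the two
-- generating sequences obey the same convolution recursion with the roles of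
-- u and v exchanged, and they agree by strong induction on the length.
module Submission where

open import Defs
open import Level using (Level)
open import Data.Nat using (ℕ; _≤_; zero; suc; _<_; s≤s) renaming (_+_ to _+ℕ_; _*_ to _*ℕ_; _∸_ to _∸ℕ_)
open import Data.Nat.Properties using (m≤m+n; m≤n+m; m≤n⇒m≤1+n)
open import Data.Nat.Induction using (<-rec)
open import Data.Bool using (Bool; true; false; if_then_else_)
open import Data.List using (List; []; _∷_; _++_; concatMap)
open import Algebra.Bundles using (CommutativeRing)
import Algebra.Properties.CommutativeSemigroup as CommutativeSemigroupProperties
open import Relation.Binary.PropositionalEquality as ≡ using (_≡_)

module DyckSums {c ℓ : Level} (R : CommutativeRing c ℓ) where
  open CommutativeRing R hiding (zero)
  open import Relation.Binary.Reasoning.Setoid setoid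
  open CommutativeSemigroupProperties +-commutativeSemigroup using (interchange)

  ∑ : {A : Set} → (A → Carrier) → List A → Carrier
  ∑ f []       = 0#
  ∑ f (x ∷ xs) = f x + ∑ f xs

  ∑-cong : {A : Set} {f g : A → Carrier} → (∀ x → f x ≈ g x) → ∀ xs → ∑ f xs ≈ ∑ g xs
  ∑-cong f≈g []       = refl
  ∑-cong f≈g (x ∷ xs) = +-cong (f≈g x) (∑-cong f≈g xs)

  ∑-+ : {A : Set} (f g : A → Carrier) → ∀ xs → ∑ (λ x → f x + g x) xs ≈ ∑ f xs + ∑ g xs
  ∑-+ f g []       = sym (+-identityʳ 0#)
  ∑-+ f g (x ∷ xs) = trans (+-cong refl (∑-+ f g xs)) (interchange _ _ _ _)

  ∑-0 : {A : Set} (xs : List A) → ∑ (λ _ → 0#) xs ≈ 0#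
  ∑-0 []       = refl
  ∑-0 (x ∷ xs) = trans (+-identityˡ _) (∑-0 xs)

  ∑-*ˡ : {A : Set} (k : Carrier) (f : A → Carrier) → ∀ xs → ∑ (λ x → k * f x) xs ≈ k * ∑ f xs
  ∑-*ˡ k f []       = sym (zeroʳ k)
  ∑-*ˡ k f (x ∷ xs) = trans (+-cong refl (∑-*ˡ k f xs)) (sym (distribˡ k _ _))

  ∑-*ʳ : {A : Set} (k : Carrier) (f : A → Carrier) → ∀ xs → ∑ (λ x → f x * k) xs ≈ ∑ f xs * k
  ∑-*ʳ k f []       = sym (zeroˡ k)
  ∑-*ʳ k f (x ∷ xs) = trans (+-cong refl (∑-*ʳ k f xs)) (sym (distribʳ k _ _))

  ∑-*-∑ : {A B : Set} (f : A → Carrier) (g : B → Carrier) → ∀ xs ys →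
          ∑ (λ x → ∑ (λ y → f x * g y) ys) xs ≈ ∑ f xs * ∑ g ys
  ∑-*-∑ f g xs ys = trans (∑-cong (λ x → ∑-*ˡ (f x) g ys) xs) (∑-*ʳ (∑ g ys) f xs)

  ∑-words-suc : (f : List Step → Carrier) → ∀ n → ∑ f (words (suc n)) ≈ ∑ (λ w → f (U ∷ w) + f (D ∷ w)) (words n)
  ∑-words-suc f n = go (words n)
    where
    go : ∀ ws → ∑ f (concatMap (λ w → (U ∷ w) ∷ (D ∷ w) ∷ []) ws) ≈ ∑ (λ w → f (U ∷ w) + f (D ∷ w)) ws
    go []       = refl
    go (w ∷ ws) = trans (+-cong refl (+-cong refl (go ws))) (sym (+-assoc _ _ _))

  guard : Bool → Carrier → Carrier
  guard p x = if p then x else 0#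

  guard-cong : ∀ p {x y} → (p ≡ true → x ≈ y) → guard p x ≈ guard p y
  guard-cong true  x≈y = x≈y ≡.refl
  guard-cong false x≈y = refl

  guard-*ˡ : ∀ p k x → guard p (k * x) ≈ k * guard p x
  guard-*ˡ true  k x = refl
  guard-*ˡ false k x = sym (zeroʳ k)

  guard-guard-* : ∀ p q x y → guard p (guard q (x * y)) ≈ guard p x * guard q y
  guard-guard-* true  true  x y = refl
  guard-guard-* true  false x y = sym (zeroʳ x)
  guard-guard-* false q     x y = sym (zeroˡ _)

  convolution : (ℕ → ℕ → Carrier) → ℕ → Carrier
  convolution H zero    = H 0 0
  convolution H (suc n) = H 0 (suc n) + convolution (λ i j → H (suc i) j) n

  convolution-cong : ∀ {H H′ : ℕ → ℕ → Carrier} n → (∀ i j → i +ℕ j ≡ n → H i j ≈ H′ i j) →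
                     convolution H n ≈ convolution H′ n
  convolution-cong zero    H≈H′ = H≈H′ 0 0 ≡.refl
  convolution-cong (suc n) H≈H′ = +-cong (H≈H′ 0 (suc n) ≡.refl) (convolution-cong n (λ i j e → H≈H′ (suc i) j (≡.cong suc e)))

  convolution-+ : ∀ (H H′ : ℕ → ℕ → Carrier) n →
                  convolution (λ i j → H i j + H′ i j) n ≈ convolution H n + convolution H′ n
  convolution-+ H H′ zero    = refl
  convolution-+ H H′ (suc n) = trans (+-cong refl (convolution-+ _ _ n)) (interchange _ _ _ _)

  convolution-snoc : ∀ (H : ℕ → ℕ → Carrier) n →
                     convolution H (suc n) ≈ convolution (λ i j → H i (suc j)) n + H (suc n) 0
  convolution-snoc H zero    = refl
  convolution-snoc H (suc n) = trans (+-cong refl (convolution-snoc (λ i j → H (suc i) j) n)) (sym (+-assoc _ _ _))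

  convolution-swap : ∀ (H : ℕ → ℕ → Carrier) n → convolution H n ≈ convolution (λ i j → H j i) n
  convolution-swap H zero    = refl
  convolution-swap H (suc n) = begin
    H 0 (suc n) + convolution (λ i j → H (suc i) j) n ≈⟨ +-cong refl (convolution-swap (λ i j → H (suc i) j) n) ⟩
    H 0 (suc n) + convolution (λ i j → H (suc j) i) n ≈⟨ +-comm _ _ ⟩
    convolution (λ i j → H (suc j) i) n + H 0 (suc n) ≈⟨ convolution-snoc (λ i j → H j i) n ⟨
    convolution (λ i j → H j i) (suc n)               ∎

  dyckSumFrom : ℕ → (List Step → Carrier) → ℕ → Carrier
  dyckSumFrom h f n = ∑ (λ w → guard (isDyckFrom h w) (f w)) (words n)

  dyckSum : (List Step → Carrier) → ℕ → Carrier
  dyckSum = dyckSumFrom 0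

  dyckSumFrom-zero-suc : ∀ g n → dyckSumFrom 0 g (suc n) ≈ dyckSumFrom 1 (λ w → g (U ∷ w)) n
  dyckSumFrom-zero-suc g n = trans (∑-words-suc _ n) (∑-cong (λ w → +-identityʳ _) (words n))

  dyckSumFrom-suc-suc : ∀ h g n → dyckSumFrom (suc h) g (suc n) ≈
    dyckSumFrom (suc (suc h)) (λ w → g (U ∷ w)) n + dyckSumFrom h (λ w → g (D ∷ w)) n
  dyckSumFrom-suc-suc h g n = trans (∑-words-suc _ n) (∑-+ _ _ (words n))

  dyckSum-cong : ∀ {f g} → (∀ w → isDyck w ≡ true → f w ≈ g w) → ∀ n → dyckSum f n ≈ dyckSum g n
  dyckSum-cong f≈g n = ∑-cong (λ w → guard-cong (isDyck w) (f≈g w)) (words n)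

  dyckSum-*ˡ : ∀ k f n → dyckSum (λ w → k * f w) n ≈ k * dyckSum f n
  dyckSum-*ˡ k f n = trans (∑-cong (λ w → guard-*ˡ (isDyck w) k (f w)) (words n)) (∑-*ˡ k _ (words n))

  -- A path from height k + h + 1 splits as u ++ D ∷ v at its first descent
  -- from h + 1 to h, where u, lowered by h + 1, is a path from height k.
  descentSplitSum : ℕ → ℕ → (List Step → Carrier) → ℕ → ℕ → Carrier
  descentSplitSum k h g i j =
    ∑ (λ u → ∑ (λ v → guard (isDyckFrom k u) (guard (isDyckFrom h v) (g (u ++ D ∷ v)))) (words j)) (words i)

  descentSplitSum-zero-zero : ∀ h g j → descentSplitSum 0 h g 0 j ≈ dyckSumFrom h (λ w → g (D ∷ w)) j
  descentSplitSum-zero-zero h g j = +-identityʳ _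

  descentSplitSum-suc-zero : ∀ k h g j → descentSplitSum (suc k) h g 0 j ≈ 0#
  descentSplitSum-suc-zero k h g j = trans (+-identityʳ _) (∑-0 (words j))

  descentSplitSum-zero-suc : ∀ h g i j → descentSplitSum 0 h g (suc i) j ≈ descentSplitSum 1 h (λ w → g (U ∷ w)) i j
  descentSplitSum-zero-suc h g i j =
    trans (∑-words-suc _ i) (∑-cong (λ u → trans (+-cong refl (∑-0 (words j))) (+-identityʳ _)) (words i))

  descentSplitSum-suc-suc : ∀ k h g i j → descentSplitSum (suc k) h g (suc i) j ≈
    descentSplitSum (suc (suc k)) h (λ w → g (U ∷ w)) i j + descentSplitSum k h (λ w → g (D ∷ w)) i j
  descentSplitSum-suc-suc k h g i j = trans (∑-words-suc _ i) (∑-+ _ _ (words i))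

  dyckSumFrom-firstDescent : ∀ n k h g →
    dyckSumFrom (suc (k +ℕ h)) g (suc n) ≈ convolution (descentSplitSum k h g) n
  dyckSumFrom-firstDescent zero    zero    h g = trans (+-identityˡ _) (sym (+-identityʳ _))
  dyckSumFrom-firstDescent zero    (suc k) h g = trans (+-identityˡ _) (sym (+-identityʳ _))
  dyckSumFrom-firstDescent (suc m) zero    h g = begin
    dyckSumFrom (suc h) g (suc (suc m))
      ≈⟨ dyckSumFrom-suc-suc h g (suc m) ⟩
    dyckSumFrom (suc (suc h)) gU (suc m) + dyckSumFrom h gD (suc m)
      ≈⟨ +-cong (dyckSumFrom-firstDescent m 1 h gU) refl ⟩
    convolution (descentSplitSum 1 h gU) m + dyckSumFrom h gD (suc m)
      ≈⟨ +-comm _ _ ⟩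
    dyckSumFrom h gD (suc m) + convolution (descentSplitSum 1 h gU) m
      ≈⟨ +-cong (descentSplitSum-zero-zero h g (suc m))
                (convolution-cong m (λ i j _ → descentSplitSum-zero-suc h g i j)) ⟨
    convolution (descentSplitSum 0 h g) (suc m) ∎
    where
    gU gD : List Step → Carrier
    gU w = g (U ∷ w)
    gD w = g (D ∷ w)
  dyckSumFrom-firstDescent (suc m) (suc k) h g = begin
    dyckSumFrom (suc (suc k +ℕ h)) g (suc (suc m))
      ≈⟨ dyckSumFrom-suc-suc (suc k +ℕ h) g (suc m) ⟩
    dyckSumFrom (suc (suc (suc k +ℕ h))) gU (suc m) + dyckSumFrom (suc (k +ℕ h)) gD (suc m)
      ≈⟨ +-cong (dyckSumFrom-firstDescent m (suc (suc k)) h gU) (dyckSumFrom-firstDescent m k h gD) ⟩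
    convolution (descentSplitSum (suc (suc k)) h gU) m + convolution (descentSplitSum k h gD) m
      ≈⟨ convolution-+ _ _ m ⟨
    convolution (λ i j → descentSplitSum (suc (suc k)) h gU i j + descentSplitSum k h gD i j) m
      ≈⟨ convolution-cong m (λ i j _ → descentSplitSum-suc-suc k h g i j) ⟨
    convolution (λ i j → descentSplitSum (suc k) h g (suc i) j) m
      ≈⟨ +-identityˡ _ ⟨
    0# + convolution (λ i j → descentSplitSum (suc k) h g (suc i) j) m
      ≈⟨ +-cong (descentSplitSum-suc-zero k h g (suc m)) refl ⟨
    convolution (descentSplitSum (suc k) h g) (suc m) ∎
    where
    gU gD : List Step → Carrier
    gU w = g (U ∷ w)
    gD w = g (D ∷ w)

  dyckSum-firstReturn : ∀ (g f f′ : List Step → Carrier) → (∀ u v → g (U ∷ (u ++ D ∷ v)) ≈ f u * f′ v) →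
    ∀ n → dyckSum g (suc (suc n)) ≈ convolution (λ i j → dyckSum f i * dyckSum f′ j) n
  dyckSum-firstReturn g f f′ g≈ff′ n = begin
    dyckSum g (suc (suc n))                               ≈⟨ dyckSumFrom-zero-suc g (suc n) ⟩
    dyckSumFrom 1 (λ w → g (U ∷ w)) (suc n)               ≈⟨ dyckSumFrom-firstDescent n 0 0 _ ⟩
    convolution (descentSplitSum 0 0 (λ w → g (U ∷ w))) n ≈⟨ convolution-cong n (λ i j _ → product i j) ⟩
    convolution (λ i j → dyckSum f i * dyckSum f′ j) n    ∎
    where
    product : ∀ i j → descentSplitSum 0 0 (λ w → g (U ∷ w)) i j ≈ dyckSum f i * dyckSum f′ j
    product i j = trans
      (∑-cong (λ u → ∑-cong (λ v → trans (guard-cong (isDyck u) (λ _ → guard-cong (isDyck v) (λ _ → g≈ff′ u v)))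
                                          (guard-guard-* (isDyck u) (isDyck v) _ _)) (words j)) (words i))
      (∑-*-∑ _ _ (words i) (words j))

  dyckSum-cong-suc : ∀ {f g} → (∀ w → isDyckFrom 1 w ≡ true → f (U ∷ w) ≈ g (U ∷ w)) →
                     ∀ n → dyckSum f (suc n) ≈ dyckSum g (suc n)
  dyckSum-cong-suc {f} {g} f≈g n = begin
    dyckSum f (suc n)                 ≈⟨ dyckSumFrom-zero-suc f n ⟩
    dyckSumFrom 1 (λ w → f (U ∷ w)) n ≈⟨ ∑-cong (λ w → guard-cong (isDyckFrom 1 w) (f≈g w)) (words n) ⟩
    dyckSumFrom 1 (λ w → g (U ∷ w)) n ≈⟨ dyckSumFrom-zero-suc g n ⟨
    dyckSum g (suc n)                 ∎

  sumDyck≡∑ : ∀ (f : List Step → Carrier) ws → sumDyck R f ws ≡ ∑ (λ w → guard (isDyck w) (f w)) ws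
  sumDyck≡∑ f []       = ≡.refl
  sumDyck≡∑ f (w ∷ ws) = ≡.cong (_ +_) (sumDyck≡∑ f ws)

module Weights {c ℓ : Level} (R : CommutativeRing c ℓ) (a b : CommutativeRing.Carrier R) where
  open CommutativeRing R hiding (zero)
  open import Relation.Binary.Reasoning.Setoid setoid
  open CommutativeSemigroupProperties *-commutativeSemigroup using (x∙yz≈y∙xz)
  open DyckSums R

  valleyWeight : Bool → List Step → Carrier
  valleyWeight afterD []      = 1#
  valleyWeight afterD (U ∷ w) = (if afterD then b else a) * valleyWeight false w
  valleyWeight afterD (D ∷ w) = valleyWeight true w

  -- beforeD: the path is followed by a down step, as the prefix u of u ++ D ∷ v is.
  startsWithD : Bool → List Step → Bool
  startsWithD beforeD []      = beforeD
  startsWithD beforeD (U ∷ _) = false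
  startsWithD beforeD (D ∷ _) = true

  peakWeight : Bool → List Step → Carrier
  peakWeight beforeD []      = 1#
  peakWeight beforeD (U ∷ w) = (if startsWithD beforeD w then a else b) * peakWeight beforeD w
  peakWeight beforeD (D ∷ w) = peakWeight beforeD w

  aOrB : ℕ → Carrier
  aOrB zero    = a
  aOrB (suc _) = b

  valleyWeight-correct : ∀ w → pow R a (upsNotInValleyAux false w) * pow R b (valleys w) ≈ valleyWeight false w
  valleyWeight-afterD-correct : ∀ w →
    pow R a (upsNotInValleyAux true w) * pow R b (valleys (D ∷ w)) ≈ valleyWeight true w
  valleyWeight-correct []      = *-identityˡ _
  valleyWeight-correct (U ∷ w) = trans (*-assoc _ _ _) (*-cong refl (valleyWeight-correct w))
  valleyWeight-correct (D ∷ w) = valleyWeight-afterD-correct w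
  valleyWeight-afterD-correct []      = *-identityˡ _
  valleyWeight-afterD-correct (U ∷ w) = trans (x∙yz≈y∙xz _ _ _) (*-cong refl (valleyWeight-correct w))
  valleyWeight-afterD-correct (D ∷ w) = valleyWeight-afterD-correct w

  peakWeight-correct : ∀ w → pow R a (peaks w) * pow R b (upsNotInPeak w) ≈ peakWeight false w
  peakWeight-correct []          = *-identityˡ _
  peakWeight-correct (D ∷ w)     = peakWeight-correct w
  peakWeight-correct (U ∷ [])    = *-identityˡ _
  peakWeight-correct (U ∷ D ∷ w) = trans (*-assoc _ _ _) (*-cong refl (peakWeight-correct w))
  peakWeight-correct (U ∷ U ∷ w) = trans (x∙yz≈y∙xz _ _ _) (*-cong refl (peakWeight-correct (U ∷ w)))

  valleyWeight-split : ∀ afterD u v → valleyWeight afterD (u ++ D ∷ v) ≈ valleyWeight afterD u * valleyWeight true v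
  valleyWeight-split afterD []      v = sym (*-identityˡ _)
  valleyWeight-split afterD (U ∷ u) v = trans (*-cong refl (valleyWeight-split false u v)) (sym (*-assoc _ _ _))
  valleyWeight-split afterD (D ∷ u) v = valleyWeight-split true u v

  startsWithD-++-D : ∀ beforeD u v → startsWithD beforeD (u ++ D ∷ v) ≡ startsWithD true u
  startsWithD-++-D beforeD []      v = ≡.refl
  startsWithD-++-D beforeD (U ∷ u) v = ≡.refl
  startsWithD-++-D beforeD (D ∷ u) v = ≡.refl

  peakWeight-split : ∀ beforeD u v → peakWeight beforeD (u ++ D ∷ v) ≈ peakWeight true u * peakWeight beforeD v
  peakWeight-split beforeD []      v = sym (*-identityˡ _)
  peakWeight-split beforeD (U ∷ u) v rewrite startsWithD-++-D beforeD u v =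
    trans (*-cong refl (peakWeight-split beforeD u v)) (sym (*-assoc _ _ _))
  peakWeight-split beforeD (D ∷ u) v = peakWeight-split beforeD u v

  -- A path ending at height 0 does not end with an up step.
  peakWeight-ending : ∀ h w → isDyckFrom h w ≡ true → peakWeight true w ≈ peakWeight false w
  peakWeight-ending-U : ∀ h w → isDyckFrom (suc h) w ≡ true → peakWeight true (U ∷ w) ≈ peakWeight false (U ∷ w)
  peakWeight-ending h       []      _    = refl
  peakWeight-ending zero    (U ∷ w) dyck = peakWeight-ending-U zero w dyck
  peakWeight-ending (suc h) (U ∷ w) dyck = peakWeight-ending-U (suc h) w dyck
  peakWeight-ending zero    (D ∷ w) ()
  peakWeight-ending (suc h) (D ∷ w) dyck = peakWeight-ending h w dyck
  peakWeight-ending-U h []      ()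
  peakWeight-ending-U h (U ∷ w) dyck = *-cong refl (peakWeight-ending (suc h) (U ∷ w) dyck)
  peakWeight-ending-U h (D ∷ w) dyck = *-cong refl (peakWeight-ending (suc h) (D ∷ w) dyck)

  valleySum peakSum : ℕ → Carrier
  valleySum = dyckSum (valleyWeight false)
  peakSum   = dyckSum (peakWeight false)

  valleySum-firstReturn : ∀ n →
    valleySum (suc (suc n)) ≈ convolution (λ i j → (a * valleySum i) * dyckSum (valleyWeight true) j) n
  valleySum-firstReturn n = trans
    (dyckSum-firstReturn _ (λ u → a * valleyWeight false u) (valleyWeight true)
      (λ u v → trans (*-cong refl (valleyWeight-split false u v)) (sym (*-assoc _ _ _))) n)
    (convolution-cong n (λ i j _ → *-cong (dyckSum-*ˡ a _ i) refl))

  peakSum-firstReturn : ∀ n →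
    peakSum (suc (suc n)) ≈ convolution (λ i j → dyckSum (λ u → peakWeight true (U ∷ u)) i * peakSum j) n
  peakSum-firstReturn = dyckSum-firstReturn _ _ _ (λ u v → peakWeight-split false (U ∷ u) v)

  valleySum-afterD : ∀ n → a * dyckSum (valleyWeight true) n ≈ aOrB n * valleySum n
  valleySum-afterD zero    = refl
  valleySum-afterD (suc n) = begin
    a * dyckSum (valleyWeight true) (suc n)          ≈⟨ dyckSum-*ˡ a _ (suc n) ⟨
    dyckSum (λ w → a * valleyWeight true w) (suc n)  ≈⟨ dyckSum-cong-suc (λ w _ → x∙yz≈y∙xz a b _) n ⟩
    dyckSum (λ w → b * valleyWeight false w) (suc n) ≈⟨ dyckSum-*ˡ b _ (suc n) ⟩
    b * valleySum (suc n)                            ∎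

  peakSum-beforeD : ∀ n → dyckSum (λ u → peakWeight true (U ∷ u)) n ≈ aOrB n * peakSum n
  peakSum-beforeD zero    = trans (+-identityʳ _) (*-cong refl (sym (+-identityʳ _)))
  peakSum-beforeD (suc n) = begin
    dyckSum (λ u → peakWeight true (U ∷ u)) (suc n) ≈⟨ dyckSum-cong-suc (λ w dyck → *-cong refl (peakWeight-ending-U 0 w dyck)) n ⟩
    dyckSum (λ u → b * peakWeight false u) (suc n)  ≈⟨ dyckSum-*ˡ b _ (suc n) ⟩
    b * peakSum (suc n)                             ∎

  valleySum≈peakSum : ∀ n → valleySum n ≈ peakSum n
  valleySum≈peakSum = <-rec (λ n → valleySum n ≈ peakSum n) step
    where
    step : ∀ n → (∀ {m} → m < n → valleySum m ≈ peakSum m) → valleySum n ≈ peakSum n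
    step zero          _  = refl
    step (suc zero)    _  = refl
    step (suc (suc n)) ih = begin
      valleySum (suc (suc n))
        ≈⟨ valleySum-firstReturn n ⟩
      convolution (λ i j → (a * valleySum i) * dyckSum (valleyWeight true) j) n
        ≈⟨ convolution-cong n (λ i j _ → trans (*-cong (*-comm _ _) refl) (*-assoc _ _ _)) ⟩
      convolution (λ i j → valleySum i * (a * dyckSum (valleyWeight true) j)) n
        ≈⟨ convolution-cong n (λ i j e → *-cong (ih (left< i j e)) (trans (valleySum-afterD j) (*-cong refl (ih (right< i j e))))) ⟩
      convolution (λ i j → peakSum i * (aOrB j * peakSum j)) n
        ≈⟨ convolution-cong n (λ i j _ → *-comm _ _) ⟩
      convolution (λ i j → (aOrB j * peakSum j) * peakSum i) n
        ≈⟨ convolution-swap (λ i j → (aOrB i * peakSum i) * peakSum j) n ⟨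
      convolution (λ i j → (aOrB i * peakSum i) * peakSum j) n
        ≈⟨ convolution-cong n (λ i j _ → *-cong (peakSum-beforeD i) refl) ⟨
      convolution (λ i j → dyckSum (λ u → peakWeight true (U ∷ u)) i * peakSum j) n
        ≈⟨ peakSum-firstReturn n ⟨
      peakSum (suc (suc n)) ∎
      where
      left< : ∀ i j → i +ℕ j ≡ n → i < suc (suc n)
      left< i j ≡.refl = s≤s (m≤n⇒m≤1+n (m≤m+n i j))
      right< : ∀ i j → i +ℕ j ≡ n → j < suc (suc n)
      right< i j ≡.refl = s≤s (m≤n⇒m≤1+n (m≤n+m j i))

proposition12 : {c ℓ : Level} (R : CommutativeRing c ℓ) →
    (a b : CommutativeRing.Carrier R) → (n : ℕ) → 1 ≤ n →
    CommutativeRing._≈_ R (cV R a b n) (cK R a b n)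
proposition12 R a b n _ = begin
  cV R a b n            ≈⟨ reflexive (sumDyck≡∑ _ paths) ⟩
  dyckSum weightV len   ≈⟨ dyckSum-cong (λ w _ → valleyWeight-correct w) len ⟩
  valleySum len         ≈⟨ valleySum≈peakSum len ⟩
  peakSum len           ≈⟨ dyckSum-cong (λ w _ → peakWeight-correct w) len ⟨
  dyckSum weightK len   ≈⟨ reflexive (sumDyck≡∑ _ paths) ⟨
  cK R a b n            ∎
  where
  open CommutativeRing R
  open import Relation.Binary.Reasoning.Setoid setoid
  open DyckSums R
  open Weights R a b
  len : ℕ
  len = 2 *ℕ (n ∸ℕ 1)
  paths : List (List Step)
  paths = words len
  weightV weightK : List Step → Carrier
  weightV w = pow R a (upsNotInValley w) * pow R b (valleys w)
  weightK w = pow R a (peaks w) * pow R b (upsNotInPeak w)
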